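{- Let $\tau$ be a permutation. Let $M_{\tau,top}$ (resp. $M_{\tau,bottom}$) be the matrix obtained by adding a row of $0$ entries above (resp. below) the permutation matrix of $\tau$, and $M_{\tau,right}$ (resp. $M_{\tau,left}$) the matrix obtained by adding a column of $0$ entries to the right (resp. left) of it. Then the permutations of $Av_{\mathfrak{S}}(M_{\tau,top})$ (resp. $Av_{\mathfrak{S}}(M_{\tau,bottom})$, $Av_{\mathfrak{S}}(M_{\tau,right})$, $Av_{\mathfrak{S}}(M_{\tau,left})$) are exactly the permutations obtained from a permutation avoiding $\tau$ by adding a new maximal (resp. minimal, last, first) element.
   Context: A permutation $\sigma$ is identified with its permutation matrix $M_\sigma$ ($M_\sigma(i,j)=1$ iff $i=\sigma(j)$, rows numbered bottom to top). A matrix $M'$ is a submatrix of $M$ if obtained by deleting rows and/or columns. $Av_{\mathfrak{S}}(M)$ is the set of permutations whose permutation matrix has no submatrix equal to $M$; a permutation avoids $\tau$ if it does not contain $\tau$ as a classical pattern. -}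

module Defs where

open import Data.Nat using (ℕ; suc)
open import Data.Fin using (Fin; zero; suc; _<_; _≟_; fromℕ; inject₁; punchIn)
open import Data.Bool using (Bool; false)
open import Data.Product using (Σ; ∃; _×_)
open import Data.Vec.Functional using (insertAt)
open import Data.Fin.Permutation using (Permutation′; _⟨$⟩ʳ_)
open import Relation.Nullary using (¬_; ⌊_⌋)
open import Relation.Binary.PropositionalEquality using (_≡_)
open import Function.Bundles using (_⇔_)

-- A 0/1 matrix with r rows and c columns; M i j is the entry in row i, column j.
-- Rows are numbered bottom to top (row 0 is the bottom row), columns left to right.
Matrix : ℕ → ℕ → Set
Matrix r c = Fin r → Fin c → Bool

permMatrix : ∀ {n} → Permutation′ n → Matrix n n
permMatrix σ i j = ⌊ i ≟ (σ ⟨$⟩ʳ j) ⌋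

StrictlyIncreasing : ∀ {a b} → (Fin a → Fin b) → Set
StrictlyIncreasing f = ∀ i j → i < j → f i < f j

IsSubmatrix : ∀ {r' c' r c} → Matrix r' c' → Matrix r c → Set
IsSubmatrix {r'} {c'} {r} {c} N M =
  Σ (Fin r' → Fin r) λ f → Σ (Fin c' → Fin c) λ g →
    StrictlyIncreasing f × StrictlyIncreasing g × (∀ i j → N i j ≡ M (f i) (g j))

AvoidsMatrix : ∀ {n r c} → Permutation′ n → Matrix r c → Set
AvoidsMatrix σ M = ¬ IsSubmatrix M (permMatrix σ)

ContainsPattern : ∀ {n k} → Permutation′ n → Permutation′ k → Set
ContainsPattern {n} {k} σ τ =
  Σ (Fin k → Fin n) λ f → StrictlyIncreasing f ×
    (∀ i j → ((σ ⟨$⟩ʳ f i) < (σ ⟨$⟩ʳ f j)) ⇔ ((τ ⟨$⟩ʳ i) < (τ ⟨$⟩ʳ j)))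

AvoidsPattern : ∀ {n k} → Permutation′ n → Permutation′ k → Set
AvoidsPattern σ τ = ¬ ContainsPattern σ τ

addTop : ∀ {r c} → Matrix r c → Matrix (suc r) c
addTop {r} M i j = insertAt (λ i' → M i' j) (fromℕ r) false i

addBottom : ∀ {r c} → Matrix r c → Matrix (suc r) c
addBottom M i j = insertAt (λ i' → M i' j) zero false i

addRight : ∀ {r c} → Matrix r c → Matrix r (suc c)
addRight {r} {c} M i = insertAt (M i) (fromℕ c) false

addLeft : ∀ {r c} → Matrix r c → Matrix r (suc c)
addLeft M i = insertAt (M i) zero false

-- σ (of size n+1) is obtained from π (of size n) by adding a new maximal element
-- (value n) at position p.
AddMax : ∀ {n} → Permutation′ (suc n) → Permutation′ n → Fin (suc n) → Set
AddMax {n} σ π p = ∀ j → σ ⟨$⟩ʳ j ≡ insertAt (λ x → inject₁ (π ⟨$⟩ʳ x)) p (fromℕ n) j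

-- new minimal element (value 0) at position p; other values shifted up.
AddMin : ∀ {n} → Permutation′ (suc n) → Permutation′ n → Fin (suc n) → Set
AddMin σ π p = ∀ j → σ ⟨$⟩ʳ j ≡ insertAt (λ x → suc (π ⟨$⟩ʳ x)) p zero j

-- new last element with value v; the other values ≥ v shifted up.
AddLast : ∀ {n} → Permutation′ (suc n) → Permutation′ n → Fin (suc n) → Set
AddLast {n} σ π v = ∀ j → σ ⟨$⟩ʳ j ≡ insertAt (λ x → punchIn v (π ⟨$⟩ʳ x)) (fromℕ n) v j

AddFirst : ∀ {n} → Permutation′ (suc n) → Permutation′ n → Fin (suc n) → Set
AddFirst σ π v = ∀ j → σ ⟨$⟩ʳ j ≡ insertAt (λ x → punchIn v (π ⟨$⟩ʳ x)) zero v j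

module Submission where

-- Proof idea.  Let k be the size of τ and n + 1 that of σ.
--
-- (1) A submatrix of M_σ equal to M_τ is the same thing as an occurrence of τ
--     in σ: its columns g form the occurrence and its rows are forced to be
--     f (τ j) = σ (g j).
-- (2) Hence a copy of M_τ padded by an empty row on top (bottom) sits in M_σ
--     iff τ occurs in σ without using the entry of value n (value 0), and a
--     copy padded by an empty column on the right (left) sits in M_σ iff τ
--     occurs in σ without using the last (first) position.  All four cases
--     say: τ occurs in σ avoiding one particular column p.
-- (3) Removal lemma: if σ is obtained from π by inserting an entry at column
--     p, the occurrences of τ in π are exactly those in σ avoiding column p;
--     since every σ arises this way from 'remove p σ', σ has no such
--     occurrence iff σ comes from a τ-avoider by an insertion at p.
-- (4) Finally, the insertions of Defs (AddMax, AddMin, AddLast, AddFirst) are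
--     rephrased as insertions at the column found in (2).

open import Defs
open import Data.Nat using (ℕ; suc; zero; z≤n; s≤s)
open import Data.Fin using (Fin)
open import Data.Product using (Σ; _×_)
open import Data.Fin.Permutation using (Permutation′)
open import Function.Bundles using (_⇔_)
import Data.Nat as ℕ
import Data.Nat.Properties as ℕ
open import Data.Fin using (zero; suc; _<_; _≟_; fromℕ; inject₁; punchIn; punchOut; toℕ)
open import Data.Fin.Properties
  using (toℕ-fromℕ; toℕ-inject₁; inject₁ℕ<; ≤fromℕ; <-cmp; <-irrefl; <-asym; <⇒≢; ≤∧≢⇒<;
         punchIn-injective; punchInᵢ≢i; punchIn-mono-≤; punchIn-punchOut)
open import Data.Fin.Permutation using (_⟨$⟩ʳ_; _⟨$⟩ˡ_; inverseʳ; inverseˡ; remove; punchIn-permute)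
open import Data.Vec.Functional using (insertAt)
open import Data.Vec.Functional.Properties using (insertAt-lookup; insertAt-punchIn)
open import Data.Product using (_,_; proj₁; proj₂)
open import Data.Bool using (true; false)
open import Level using (0ℓ)
open import Relation.Nullary using (¬_; yes; no; contradiction)
open import Relation.Nullary.Decidable using (isYes≗does; does-⇔; dec-false)
open import Relation.Binary using (Setoid; tri<; tri≈; tri>)
open import Relation.Binary.PropositionalEquality
  using (_≡_; _≢_; refl; sym; trans; cong; subst; subst₂; module ≡-Reasoning)
open import Function using (_∘_)
open import Function.Bundles using (mk⇔; Injection; module Equivalence)
open import Function.Properties.Inverse using (↔⇒↣)
open import Function.Properties.Equivalence using (⇔-setoid)
open import Function.Related.TypeIsomorphisms using (¬-cong-⇔)
import Relation.Binary.Reasoning.Setoid as SetoidReasoning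

open Equivalence using (to; from)
open Setoid (⇔-setoid 0ℓ) using () renaming (trans to ⇔-trans; sym to ⇔-sym)

private
  variable
    k m n : ℕ

Perm : ℕ → Set
Perm = Permutation′

permutation-injective : (σ : Perm m) {x y : Fin m} → σ ⟨$⟩ʳ x ≡ σ ⟨$⟩ʳ y → x ≡ y
permutation-injective σ = Injection.injective (↔⇒↣ σ)

strictlyIncreasing-injective : ∀ {a b} (f : Fin a → Fin b) → StrictlyIncreasing f →
  ∀ {i j} → f i ≡ f j → i ≡ j
strictlyIncreasing-injective f inc {i} {j} fi≡fj with <-cmp i j
... | tri< i<j _ _ = contradiction fi≡fj (<⇒≢ (inc i j i<j))
... | tri≈ _ i≡j _ = i≡j
... | tri> _ _ j<i = contradiction (sym fi≡fj) (<⇒≢ (inc j i j<i))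

strictlyIncreasing-reflects : ∀ {a b} (f : Fin a → Fin b) → StrictlyIncreasing f →
  ∀ {i j} → f i < f j → i < j
strictlyIncreasing-reflects f inc {i} {j} fi<fj with <-cmp i j
... | tri< i<j _ _ = i<j
... | tri≈ _ refl _ = contradiction fi<fj (<-irrefl refl)
... | tri> _ _ j<i = contradiction fi<fj (<-asym (inc j i j<i))

strictlyIncreasing-<⇔ : ∀ {a b} (f : Fin a → Fin b) → StrictlyIncreasing f →
  ∀ i j → (f i < f j) ⇔ (i < j)
strictlyIncreasing-<⇔ f inc i j =
  mk⇔ (strictlyIncreasing-reflects f inc) (inc i j)

punchIn-strictlyIncreasing : (p : Fin (suc n)) → StrictlyIncreasing (punchIn p)
punchIn-strictlyIncreasing p i j i<j =
  ≤∧≢⇒< (punchIn-mono-≤ p i j (ℕ.<⇒≤ i<j)) (<⇒≢ i<j ∘ punchIn-injective p i j)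

inject₁-strictlyIncreasing : StrictlyIncreasing (inject₁ {n})
inject₁-strictlyIncreasing i j =
  subst₂ ℕ._<_ (sym (toℕ-inject₁ i)) (sym (toℕ-inject₁ j))

inject₁<fromℕ : (r : Fin k) → inject₁ r < fromℕ k
inject₁<fromℕ {k} r = subst (toℕ (inject₁ r) ℕ.<_) (sym (toℕ-fromℕ k)) (inject₁ℕ< r)

punchIn-fromℕ : (x : Fin n) → punchIn (fromℕ n) x ≡ inject₁ x
punchIn-fromℕ zero = refl
punchIn-fromℕ (suc x) = cong suc (punchIn-fromℕ x)

insertAt-fromℕ-inject₁ : ∀ {a} {A : Set a} (xs : Fin k → A) (v : A) (r : Fin k) →
  insertAt xs (fromℕ k) v (inject₁ r) ≡ xs r
insertAt-fromℕ-inject₁ {k} xs v r =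
  trans (cong (insertAt xs (fromℕ k) v) (sym (punchIn-fromℕ r))) (insertAt-punchIn xs (fromℕ k) v r)

data LastView : ∀ {k} → Fin (suc k) → Set where
  last : ∀ {k} → LastView (fromℕ k)
  old : ∀ {k} (r : Fin k) → LastView (inject₁ r)

lastView : (i : Fin (suc k)) → LastView i
lastView {zero} zero = last
lastView {suc k} zero = old zero
lastView {suc k} (suc i) with lastView i
... | last = last
... | old r = old (suc r)

snoc-strictlyIncreasing : (h : Fin k → Fin (suc n)) → StrictlyIncreasing h → (∀ r → h r ≢ fromℕ n) →
  StrictlyIncreasing (insertAt h (fromℕ k) (fromℕ n))
snoc-strictlyIncreasing {k} {n} h inc h≢n i j i<j with lastView i | lastView j
... | last | last = contradiction i<j (<-irrefl refl)
... | last | old r = contradiction (inject₁<fromℕ r) (<-asym i<j)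
... | old r | last
  rewrite insertAt-fromℕ-inject₁ h (fromℕ n) r | insertAt-lookup h (fromℕ k) (fromℕ n) =
  ≤∧≢⇒< (≤fromℕ (h r)) (h≢n r)
... | old r | old r′
  rewrite insertAt-fromℕ-inject₁ h (fromℕ n) r | insertAt-fromℕ-inject₁ h (fromℕ n) r′ =
  inc r r′ (strictlyIncreasing-reflects inject₁ inject₁-strictlyIncreasing i<j)

cons-strictlyIncreasing : (h : Fin k → Fin (suc n)) → StrictlyIncreasing h → (∀ r → h r ≢ zero) →
  StrictlyIncreasing (insertAt h zero zero)
cons-strictlyIncreasing h inc h≢0 zero (suc j) _ with h j | h≢0 j
... | zero | h≢0j = contradiction refl h≢0j
... | suc _ | _ = s≤s z≤n
cons-strictlyIncreasing h inc h≢0 (suc i) (suc j) (s≤s i<j) = inc i j i<j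

Occurrence : Perm m → Perm k → (Fin k → Fin m) → Set
Occurrence σ τ g =
  StrictlyIncreasing g × (∀ i j → ((σ ⟨$⟩ʳ g i) < (σ ⟨$⟩ʳ g j)) ⇔ ((τ ⟨$⟩ʳ i) < (τ ⟨$⟩ʳ j)))

OccurrenceAvoiding : Perm m → Perm k → Fin m → Set
OccurrenceAvoiding {m} {k} σ τ p =
  Σ (Fin k → Fin m) λ g → Occurrence σ τ g × (∀ j → g j ≢ p)

permMatrix-one : (σ : Perm m) {i j : Fin m} → permMatrix σ i j ≡ true → i ≡ σ ⟨$⟩ʳ j
permMatrix-one σ {i} {j} one with i ≟ σ ⟨$⟩ʳ j
... | yes i≡σj = i≡σj

permMatrix-graph : (σ : Perm m) (j : Fin m) → permMatrix σ (σ ⟨$⟩ʳ j) j ≡ true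
permMatrix-graph σ j with σ ⟨$⟩ʳ j ≟ σ ⟨$⟩ʳ j
... | yes _ = refl
... | no σj≢σj = contradiction refl σj≢σj

permMatrix-zero : (σ : Perm m) {i j : Fin m} → i ≢ σ ⟨$⟩ʳ j → permMatrix σ i j ≡ false
permMatrix-zero σ {i} {j} i≢σj =
  trans (isYes≗does (i ≟ σ ⟨$⟩ʳ j)) (dec-false (i ≟ σ ⟨$⟩ʳ j) i≢σj)

permMatrix-cong : (τ : Perm k) (σ : Perm m) {r j : Fin k} {i j′ : Fin m} →
  (r ≡ τ ⟨$⟩ʳ j) ⇔ (i ≡ σ ⟨$⟩ʳ j′) → permMatrix τ r j ≡ permMatrix σ i j′
permMatrix-cong τ σ {r} {j} {i} {j′} same = begin
  permMatrix τ r j        ≡⟨ isYes≗does (r ≟ τ ⟨$⟩ʳ j) ⟩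
  _                       ≡⟨ does-⇔ same (r ≟ τ ⟨$⟩ʳ j) (i ≟ σ ⟨$⟩ʳ j′) ⟩
  _                       ≡⟨ sym (isYes≗does (i ≟ σ ⟨$⟩ʳ j′)) ⟩
  permMatrix σ i j′       ∎
  where open ≡-Reasoning

embedding⇒occurrence : (σ : Perm m) (τ : Perm k) (f g : Fin k → Fin m) →
  StrictlyIncreasing f → StrictlyIncreasing g →
  (∀ r j → permMatrix τ r j ≡ permMatrix σ (f r) (g j)) →
  Occurrence σ τ g × (∀ j → f (τ ⟨$⟩ʳ j) ≡ σ ⟨$⟩ʳ g j)
embedding⇒occurrence σ τ f g f-inc g-inc copy = (g-inc , order) , rows
  where
  rows : ∀ j → f (τ ⟨$⟩ʳ j) ≡ σ ⟨$⟩ʳ g j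
  rows j = permMatrix-one σ (trans (sym (copy (τ ⟨$⟩ʳ j) j)) (permMatrix-graph τ j))
  order : ∀ i j → ((σ ⟨$⟩ʳ g i) < (σ ⟨$⟩ʳ g j)) ⇔ ((τ ⟨$⟩ʳ i) < (τ ⟨$⟩ʳ j))
  order i j = subst₂ (λ a b → (a < b) ⇔ _) (rows i) (rows j)
    (strictlyIncreasing-<⇔ f f-inc (τ ⟨$⟩ʳ i) (τ ⟨$⟩ʳ j))

-- (1b) Conversely, an occurrence g gives a copy of M_τ in the rows σ ∘ g ∘ τ⁻¹.
occurrenceRows : Perm m → Perm k → (Fin k → Fin m) → Fin k → Fin m
occurrenceRows σ τ g r = σ ⟨$⟩ʳ g (τ ⟨$⟩ˡ r)

occurrenceRows-strictlyIncreasing : (σ : Perm m) (τ : Perm k) (g : Fin k → Fin m) → Occurrence σ τ g →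
  StrictlyIncreasing (occurrenceRows σ τ g)
occurrenceRows-strictlyIncreasing σ τ g (_ , order) r r′ r<r′ =
  from (order (τ ⟨$⟩ˡ r) (τ ⟨$⟩ˡ r′)) (subst₂ _<_ (sym (inverseʳ τ)) (sym (inverseʳ τ)) r<r′)

occurrence-copy : (σ : Perm m) (τ : Perm k) (g : Fin k → Fin m) → Occurrence σ τ g →
  ∀ r j → permMatrix τ r j ≡ permMatrix σ (occurrenceRows σ τ g r) (g j)
occurrence-copy σ τ g (g-inc , _) r j = permMatrix-cong τ σ (mk⇔ onGraph offGraph)
  where
  onGraph : r ≡ τ ⟨$⟩ʳ j → occurrenceRows σ τ g r ≡ σ ⟨$⟩ʳ g j
  onGraph refl = cong (λ x → σ ⟨$⟩ʳ g x) (inverseˡ τ)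
  offGraph : occurrenceRows σ τ g r ≡ σ ⟨$⟩ʳ g j → r ≡ τ ⟨$⟩ʳ j
  offGraph same = trans (sym (inverseʳ τ))
    (cong (τ ⟨$⟩ʳ_) (strictlyIncreasing-injective g g-inc (permutation-injective σ same)))

avoidsColumn⇒avoidsValue : (σ : Perm m) {g : Fin k → Fin m} {v : Fin m} →
  (∀ j → g j ≢ σ ⟨$⟩ˡ v) → ∀ j → σ ⟨$⟩ʳ g j ≢ v
avoidsColumn⇒avoidsValue σ avoid j σgj≡v = avoid j (trans (sym (inverseˡ σ)) (cong (σ ⟨$⟩ˡ_) σgj≡v))

occurrenceRows-avoid : (σ : Perm m) (τ : Perm k) {g : Fin k → Fin m} {v : Fin m} →
  (∀ j → g j ≢ σ ⟨$⟩ˡ v) → ∀ r → occurrenceRows σ τ g r ≢ v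
occurrenceRows-avoid σ τ avoid r = avoidsColumn⇒avoidsValue σ avoid (τ ⟨$⟩ˡ r)

topPadding : (σ : Perm (suc n)) (τ : Perm k) →
  IsSubmatrix (addTop (permMatrix τ)) (permMatrix σ) ⇔ OccurrenceAvoiding σ τ (σ ⟨$⟩ˡ fromℕ n)
topPadding {n} {k} σ τ = mk⇔ restrict extend
  where
  restrict : IsSubmatrix (addTop (permMatrix τ)) (permMatrix σ) → OccurrenceAvoiding σ τ (σ ⟨$⟩ˡ fromℕ n)
  restrict (f , g , f-inc , g-inc , copy) = g , proj₁ found , avoid
    where
    found : Occurrence σ τ g × (∀ j → f (inject₁ (τ ⟨$⟩ʳ j)) ≡ σ ⟨$⟩ʳ g j)
    found = embedding⇒occurrence σ τ (f ∘ inject₁) g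
      (λ r r′ → f-inc _ _ ∘ inject₁-strictlyIncreasing r r′) g-inc
      (λ r j → trans (sym (insertAt-fromℕ-inject₁ (λ i → permMatrix τ i j) false r)) (copy (inject₁ r) j))
    -- σ (g j) = f (τ j) lies strictly below the empty row f (last) ≤ n.
    avoid : ∀ j → g j ≢ σ ⟨$⟩ˡ fromℕ n
    avoid j gj≡ = ℕ.<⇒≱ below (≤fromℕ (f (fromℕ k)))
      where
      below : fromℕ n < f (fromℕ k)
      below = subst (_< f (fromℕ k)) (trans (proj₂ found j) (trans (cong (σ ⟨$⟩ʳ_) gj≡) (inverseʳ σ)))
                (f-inc _ _ (inject₁<fromℕ (τ ⟨$⟩ʳ j)))
  extend : OccurrenceAvoiding σ τ (σ ⟨$⟩ˡ fromℕ n) → IsSubmatrix (addTop (permMatrix τ)) (permMatrix σ)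
  extend (g , occ , avoid) = rows , g , rows-inc , proj₁ occ , copy
    where
    rows : Fin (suc k) → Fin (suc n)
    rows = insertAt (occurrenceRows σ τ g) (fromℕ k) (fromℕ n)
    rows-inc : StrictlyIncreasing rows
    rows-inc = snoc-strictlyIncreasing (occurrenceRows σ τ g)
      (occurrenceRows-strictlyIncreasing σ τ g occ) (occurrenceRows-avoid σ τ avoid)
    copy : ∀ i j → addTop (permMatrix τ) i j ≡ permMatrix σ (rows i) (g j)
    copy i j with lastView i
    ... | last rewrite insertAt-lookup (λ i′ → permMatrix τ i′ j) (fromℕ k) false
                     | insertAt-lookup (occurrenceRows σ τ g) (fromℕ k) (fromℕ n) =
      sym (permMatrix-zero σ (avoidsColumn⇒avoidsValue σ avoid j ∘ sym))
    ... | old r rewrite insertAt-fromℕ-inject₁ (λ i′ → permMatrix τ i′ j) false r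
                      | insertAt-fromℕ-inject₁ (occurrenceRows σ τ g) (fromℕ n) r =
      occurrence-copy σ τ g occ r j

bottomPadding : (σ : Perm (suc n)) (τ : Perm k) →
  IsSubmatrix (addBottom (permMatrix τ)) (permMatrix σ) ⇔ OccurrenceAvoiding σ τ (σ ⟨$⟩ˡ zero)
bottomPadding {n} {k} σ τ = mk⇔ restrict extend
  where
  restrict : IsSubmatrix (addBottom (permMatrix τ)) (permMatrix σ) → OccurrenceAvoiding σ τ (σ ⟨$⟩ˡ zero)
  restrict (f , g , f-inc , g-inc , copy) = g , proj₁ found , avoid
    where
    found : Occurrence σ τ g × (∀ j → f (suc (τ ⟨$⟩ʳ j)) ≡ σ ⟨$⟩ʳ g j)
    found = embedding⇒occurrence σ τ (f ∘ suc) g (λ r r′ → f-inc _ _ ∘ s≤s) g-inc (copy ∘ suc)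
    -- σ (g j) = f (τ j + 1) lies strictly above the empty row f 0 ≥ 0.
    avoid : ∀ j → g j ≢ σ ⟨$⟩ˡ zero
    avoid j gj≡ with f zero | f-inc zero (suc (τ ⟨$⟩ʳ j)) (s≤s z≤n)
    ... | _ | above
      with () ← subst (_ <_) (trans (proj₂ found j) (trans (cong (σ ⟨$⟩ʳ_) gj≡) (inverseʳ σ))) above
  extend : OccurrenceAvoiding σ τ (σ ⟨$⟩ˡ zero) → IsSubmatrix (addBottom (permMatrix τ)) (permMatrix σ)
  extend (g , occ , avoid) = rows , g , rows-inc , proj₁ occ , copy
    where
    rows : Fin (suc k) → Fin (suc n)
    rows = insertAt (occurrenceRows σ τ g) zero zero
    rows-inc : StrictlyIncreasing rows
    rows-inc = cons-strictlyIncreasing (occurrenceRows σ τ g)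
      (occurrenceRows-strictlyIncreasing σ τ g occ) (occurrenceRows-avoid σ τ avoid)
    copy : ∀ i j → addBottom (permMatrix τ) i j ≡ permMatrix σ (rows i) (g j)
    copy zero j = sym (permMatrix-zero σ (avoidsColumn⇒avoidsValue σ avoid j ∘ sym))
    copy (suc r) j = occurrence-copy σ τ g occ r j

rightPadding : (σ : Perm (suc n)) (τ : Perm k) →
  IsSubmatrix (addRight (permMatrix τ)) (permMatrix σ) ⇔ OccurrenceAvoiding σ τ (fromℕ n)
rightPadding {n} {k} σ τ = mk⇔ restrict extend
  where
  restrict : IsSubmatrix (addRight (permMatrix τ)) (permMatrix σ) → OccurrenceAvoiding σ τ (fromℕ n)
  restrict (f , g , f-inc , g-inc , copy) = g ∘ inject₁ , proj₁ found , avoid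
    where
    found : Occurrence σ τ (g ∘ inject₁) × (∀ j → f (τ ⟨$⟩ʳ j) ≡ σ ⟨$⟩ʳ g (inject₁ j))
    found = embedding⇒occurrence σ τ f (g ∘ inject₁) f-inc
      (λ r r′ → g-inc _ _ ∘ inject₁-strictlyIncreasing r r′)
      (λ r j → trans (sym (insertAt-fromℕ-inject₁ (permMatrix τ r) false j)) (copy r (inject₁ j)))
    -- g (inject₁ j) lies strictly left of the empty column g (last) ≤ n.
    avoid : ∀ j → g (inject₁ j) ≢ fromℕ n
    avoid j gj≡n =
      ℕ.<⇒≱ (subst (_< g (fromℕ k)) gj≡n (g-inc _ _ (inject₁<fromℕ j))) (≤fromℕ (g (fromℕ k)))
  extend : OccurrenceAvoiding σ τ (fromℕ n) → IsSubmatrix (addRight (permMatrix τ)) (permMatrix σ)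
  extend (g , occ , avoid) =
    occurrenceRows σ τ g , columns , occurrenceRows-strictlyIncreasing σ τ g occ , columns-inc , copy
    where
    columns : Fin (suc k) → Fin (suc n)
    columns = insertAt g (fromℕ k) (fromℕ n)
    columns-inc : StrictlyIncreasing columns
    columns-inc = snoc-strictlyIncreasing g (proj₁ occ) avoid
    copy : ∀ i j → addRight (permMatrix τ) i j ≡ permMatrix σ (occurrenceRows σ τ g i) (columns j)
    copy r j with lastView j
    ... | last rewrite insertAt-lookup (permMatrix τ r) (fromℕ k) false
                     | insertAt-lookup g (fromℕ k) (fromℕ n) =
      sym (permMatrix-zero σ (avoid (τ ⟨$⟩ˡ r) ∘ permutation-injective σ))
    ... | old j′ rewrite insertAt-fromℕ-inject₁ (permMatrix τ r) false j′
                       | insertAt-fromℕ-inject₁ g (fromℕ n) j′ =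
      occurrence-copy σ τ g occ r j′

leftPadding : (σ : Perm (suc n)) (τ : Perm k) →
  IsSubmatrix (addLeft (permMatrix τ)) (permMatrix σ) ⇔ OccurrenceAvoiding σ τ zero
leftPadding {n} {k} σ τ = mk⇔ restrict extend
  where
  restrict : IsSubmatrix (addLeft (permMatrix τ)) (permMatrix σ) → OccurrenceAvoiding σ τ zero
  restrict (f , g , f-inc , g-inc , copy) = g ∘ suc , proj₁ found , avoid
    where
    found : Occurrence σ τ (g ∘ suc) × (∀ j → f (τ ⟨$⟩ʳ j) ≡ σ ⟨$⟩ʳ g (suc j))
    found = embedding⇒occurrence σ τ f (g ∘ suc) f-inc (λ r r′ → g-inc _ _ ∘ s≤s) (λ r j → copy r (suc j))
    -- g (j + 1) lies strictly right of the empty column g 0 ≥ 0.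
    avoid : ∀ j → g (suc j) ≢ zero
    avoid j gj≡0 with () ← subst (g zero <_) gj≡0 (g-inc zero (suc j) (s≤s z≤n))
  extend : OccurrenceAvoiding σ τ zero → IsSubmatrix (addLeft (permMatrix τ)) (permMatrix σ)
  extend (g , occ , avoid) =
    occurrenceRows σ τ g , columns , occurrenceRows-strictlyIncreasing σ τ g occ , columns-inc , copy
    where
    columns : Fin (suc k) → Fin (suc n)
    columns = insertAt g zero zero
    columns-inc : StrictlyIncreasing columns
    columns-inc = cons-strictlyIncreasing g (proj₁ occ) avoid
    copy : ∀ i j → addLeft (permMatrix τ) i j ≡ permMatrix σ (occurrenceRows σ τ g i) (columns j)
    copy r zero = sym (permMatrix-zero σ (avoid (τ ⟨$⟩ˡ r) ∘ permutation-injective σ))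
    copy r (suc j) = occurrence-copy σ τ g occ r j

record Inserted (σ : Perm (suc n)) (π : Perm n) (p v : Fin (suc n)) : Set where
  constructor inserted
  field
    value : σ ⟨$⟩ʳ p ≡ v
    shifted : ∀ x → σ ⟨$⟩ʳ punchIn p x ≡ punchIn v (π ⟨$⟩ʳ x)

remove-inserted : (σ : Perm (suc n)) (p : Fin (suc n)) → Inserted σ (remove p σ) p (σ ⟨$⟩ʳ p)
remove-inserted σ p = inserted refl (punchIn-permute σ p)

inserted-occurrences : {σ : Perm (suc n)} {π : Perm n} {p v : Fin (suc n)} (τ : Perm k) →
  Inserted σ π p v → ContainsPattern π τ ⇔ OccurrenceAvoiding σ τ p
inserted-occurrences {n} {k} {σ} {π} {p} {v} τ (inserted _ shifted) = mk⇔ lift restrict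
  where
  sameOrder : (g : Fin k → Fin (suc n)) (h : Fin k → Fin n) → (∀ j → punchIn p (h j) ≡ g j) →
    ∀ i j → ((σ ⟨$⟩ʳ g i) < (σ ⟨$⟩ʳ g j)) ⇔ ((π ⟨$⟩ʳ h i) < (π ⟨$⟩ʳ h j))
  sameOrder g h g≡ i j rewrite sym (g≡ i) | sym (g≡ j) | shifted (h i) | shifted (h j) =
    strictlyIncreasing-<⇔ (punchIn v) (punchIn-strictlyIncreasing v) _ _
  transfer : (g : Fin k → Fin (suc n)) (h : Fin k → Fin n) → (∀ j → punchIn p (h j) ≡ g j) →
    Occurrence σ τ g ⇔ Occurrence π τ h
  transfer g h g≡ = mk⇔
    (λ (g-inc , order) → h-inc g-inc , λ i j → ⇔-trans (⇔-sym (sameOrder g h g≡ i j)) (order i j))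
    (λ (h-inc , order) → g-inc h-inc , λ i j → ⇔-trans (sameOrder g h g≡ i j) (order i j))
    where
    h-inc : StrictlyIncreasing g → StrictlyIncreasing h
    h-inc g-inc i j i<j = strictlyIncreasing-reflects (punchIn p) (punchIn-strictlyIncreasing p)
      (subst₂ _<_ (sym (g≡ i)) (sym (g≡ j)) (g-inc i j i<j))
    g-inc : StrictlyIncreasing h → StrictlyIncreasing g
    g-inc h-inc i j i<j = subst₂ _<_ (g≡ i) (g≡ j) (punchIn-strictlyIncreasing p _ _ (h-inc i j i<j))
  lift : ContainsPattern π τ → OccurrenceAvoiding σ τ p
  lift (h , occ) =
    punchIn p ∘ h , from (transfer (punchIn p ∘ h) h (λ _ → refl)) occ , λ j → punchInᵢ≢i p (h j)
  restrict : OccurrenceAvoiding σ τ p → ContainsPattern π τ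
  restrict (g , occ , avoid) = h , to (transfer g h (λ j → punchIn-punchOut _)) occ
    where
    h : Fin k → Fin n
    h j = punchOut (avoid j ∘ sym)

FromAvoider : Perm k → (Perm n → Fin (suc n) → Set) → Set
FromAvoider {k} {n} τ Ins = Σ (Perm n) λ π → Σ (Fin (suc n)) λ q → AvoidsPattern π τ × Ins π q

removal : (σ : Perm (suc n)) (τ : Perm k) (p : Fin (suc n)) →
  (¬ OccurrenceAvoiding σ τ p) ⇔ FromAvoider τ (λ π v → Inserted σ π p v)
removal σ τ p = mk⇔
  (λ none → remove p σ , σ ⟨$⟩ʳ p ,
     none ∘ to (inserted-occurrences τ (remove-inserted σ p)) , remove-inserted σ p)
  (λ (_ , _ , avoids , ins) → avoids ∘ from (inserted-occurrences τ ins))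

Σ-⇔ : {A : Set} {P Q : A → Set} → (∀ a → P a ⇔ Q a) → Σ A P ⇔ Σ A Q
Σ-⇔ P⇔Q = mk⇔ (λ (a , Pa) → a , to (P⇔Q a) Pa) (λ (a , Qa) → a , from (P⇔Q a) Qa)

fromAvoider-cong : (τ : Perm k) {P Q : Perm n → Fin (suc n) → Set} →
  (∀ π → Σ (Fin (suc n)) (P π) ⇔ Σ (Fin (suc n)) (Q π)) → FromAvoider τ P ⇔ FromAvoider τ Q
fromAvoider-cong {n = n} τ P⇔Q = mk⇔ (transport (to ∘ P⇔Q)) (transport (from ∘ P⇔Q))
  where
  transport : {P Q : Perm n → Fin (suc n) → Set} →
    (∀ π → Σ (Fin (suc n)) (P π) → Σ (Fin (suc n)) (Q π)) → FromAvoider τ P → FromAvoider τ Q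
  transport change (π , q , avoids , ins) with change π (q , ins)
  ... | q′ , ins′ = π , q′ , avoids , ins′

insertedAtValue : (σ : Perm (suc n)) (π : Perm n) (w : Fin (suc n)) →
  Σ (Fin (suc n)) (Inserted σ π (σ ⟨$⟩ˡ w)) ⇔ Σ (Fin (suc n)) (λ p → Inserted σ π p w)
insertedAtValue σ π w = mk⇔
  (λ (_ , ins) → σ ⟨$⟩ˡ w ,
     subst (Inserted σ π (σ ⟨$⟩ˡ w)) (trans (sym (Inserted.value ins)) (inverseʳ σ)) ins)
  (λ (_ , ins) → w ,
     subst (λ q → Inserted σ π q w) (trans (sym (inverseˡ σ)) (cong (σ ⟨$⟩ˡ_) (Inserted.value ins))) ins)

inserted⇔insertAt : (σ : Perm (suc n)) (π : Perm n) (p v : Fin (suc n)) (ys : Fin n → Fin (suc n)) →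
  (∀ x → ys x ≡ punchIn v (π ⟨$⟩ʳ x)) →
  Inserted σ π p v ⇔ (∀ j → σ ⟨$⟩ʳ j ≡ insertAt ys p v j)
inserted⇔insertAt σ π p v ys ys≡ = mk⇔ pointwise fromPointwise
  where
  open ≡-Reasoning
  fromPointwise : (∀ j → σ ⟨$⟩ʳ j ≡ insertAt ys p v j) → Inserted σ π p v
  fromPointwise σ≡ = inserted (trans (σ≡ p) (insertAt-lookup ys p v))
    (λ x → trans (σ≡ (punchIn p x)) (trans (insertAt-punchIn ys p v x) (ys≡ x)))
  pointwise : Inserted σ π p v → ∀ j → σ ⟨$⟩ʳ j ≡ insertAt ys p v j
  pointwise (inserted value shifted) j with p ≟ j
  ... | yes refl = trans value (sym (insertAt-lookup ys p v))
  ... | no p≢j = begin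
    σ ⟨$⟩ʳ j                        ≡⟨ cong (σ ⟨$⟩ʳ_) (sym (punchIn-punchOut p≢j)) ⟩
    σ ⟨$⟩ʳ punchIn p x              ≡⟨ shifted x ⟩
    punchIn v (π ⟨$⟩ʳ x)            ≡⟨ sym (ys≡ x) ⟩
    ys x                            ≡⟨ sym (insertAt-punchIn ys p v x) ⟩
    insertAt ys p v (punchIn p x)   ≡⟨ cong (insertAt ys p v) (punchIn-punchOut p≢j) ⟩
    insertAt ys p v j               ∎
    where
    x : Fin _
    x = punchOut p≢j

module _ {k n : ℕ} (τ : Perm k) (σ : Perm (suc n)) where
  open SetoidReasoning (⇔-setoid 0ℓ)

  topCase : AvoidsMatrix σ (addTop (permMatrix τ)) ⇔ FromAvoider τ (AddMax σ)
  topCase = begin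
    AvoidsMatrix σ (addTop (permMatrix τ))
      ≈⟨ ¬-cong-⇔ (topPadding σ τ) ⟩
    ¬ OccurrenceAvoiding σ τ (σ ⟨$⟩ˡ fromℕ n)
      ≈⟨ removal σ τ (σ ⟨$⟩ˡ fromℕ n) ⟩
    FromAvoider τ (λ π v → Inserted σ π (σ ⟨$⟩ˡ fromℕ n) v)
      ≈⟨ fromAvoider-cong τ (λ π → insertedAtValue σ π (fromℕ n)) ⟩
    FromAvoider τ (λ π p → Inserted σ π p (fromℕ n))
      ≈⟨ fromAvoider-cong τ (λ π → Σ-⇔ λ p →
           inserted⇔insertAt σ π p (fromℕ n) _ (sym ∘ punchIn-fromℕ ∘ (π ⟨$⟩ʳ_))) ⟩
    FromAvoider τ (AddMax σ)
      ∎

  bottomCase : AvoidsMatrix σ (addBottom (permMatrix τ)) ⇔ FromAvoider τ (AddMin σ)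
  bottomCase = begin
    AvoidsMatrix σ (addBottom (permMatrix τ))
      ≈⟨ ¬-cong-⇔ (bottomPadding σ τ) ⟩
    ¬ OccurrenceAvoiding σ τ (σ ⟨$⟩ˡ zero)
      ≈⟨ removal σ τ (σ ⟨$⟩ˡ zero) ⟩
    FromAvoider τ (λ π v → Inserted σ π (σ ⟨$⟩ˡ zero) v)
      ≈⟨ fromAvoider-cong τ (λ π → insertedAtValue σ π zero) ⟩
    FromAvoider τ (λ π p → Inserted σ π p zero)
      ≈⟨ fromAvoider-cong τ (λ π → Σ-⇔ λ p → inserted⇔insertAt σ π p zero _ (λ _ → refl)) ⟩
    FromAvoider τ (AddMin σ)
      ∎

  rightCase : AvoidsMatrix σ (addRight (permMatrix τ)) ⇔ FromAvoider τ (AddLast σ)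
  rightCase = begin
    AvoidsMatrix σ (addRight (permMatrix τ))
      ≈⟨ ¬-cong-⇔ (rightPadding σ τ) ⟩
    ¬ OccurrenceAvoiding σ τ (fromℕ n)
      ≈⟨ removal σ τ (fromℕ n) ⟩
    FromAvoider τ (λ π v → Inserted σ π (fromℕ n) v)
      ≈⟨ fromAvoider-cong τ (λ π → Σ-⇔ λ v → inserted⇔insertAt σ π (fromℕ n) v _ (λ _ → refl)) ⟩
    FromAvoider τ (AddLast σ)
      ∎

  leftCase : AvoidsMatrix σ (addLeft (permMatrix τ)) ⇔ FromAvoider τ (AddFirst σ)
  leftCase = begin
    AvoidsMatrix σ (addLeft (permMatrix τ))
      ≈⟨ ¬-cong-⇔ (leftPadding σ τ) ⟩
    ¬ OccurrenceAvoiding σ τ zero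
      ≈⟨ removal σ τ zero ⟩
    FromAvoider τ (λ π v → Inserted σ π zero v)
      ≈⟨ fromAvoider-cong τ (λ π → Σ-⇔ λ v → inserted⇔insertAt σ π zero v _ (λ _ → refl)) ⟩
    FromAvoider τ (AddFirst σ)
      ∎

mainTheorem14 : ∀ {k} (τ : Permutation′ k) (n : ℕ) (σ : Permutation′ (suc n)) →
    (AvoidsMatrix σ (addTop (permMatrix τ)) ⇔
       Σ (Permutation′ n) λ π → Σ (Fin (suc n)) λ p → AvoidsPattern π τ × AddMax σ π p)
    × (AvoidsMatrix σ (addBottom (permMatrix τ)) ⇔
       Σ (Permutation′ n) λ π → Σ (Fin (suc n)) λ p → AvoidsPattern π τ × AddMin σ π p)
    × (AvoidsMatrix σ (addRight (permMatrix τ)) ⇔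
       Σ (Permutation′ n) λ π → Σ (Fin (suc n)) λ v → AvoidsPattern π τ × AddLast σ π v)
    × (AvoidsMatrix σ (addLeft (permMatrix τ)) ⇔
       Σ (Permutation′ n) λ π → Σ (Fin (suc n)) λ v → AvoidsPattern π τ × AddFirst σ π v)
mainTheorem14 τ n σ = topCase τ σ , bottomCase τ σ , rightCase τ σ , leftCase τ σ
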